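{- Let $P$ be a finite bounded poset, let $\hat0=x_0\lessdot x_1\lessdot\cdots\lessdot x_n=\hat1$ be a left modular maximal chain of $P$, let $l_1<\cdots<l_n$ be integers, and let $\gamma$ be the edge-labelling of $P$ induced by this chain and the label set $\{l_i\}$. Let $y<z$ in $P$. The elements $(x_j\vee y)\wedge_y z$, $j=0,\dots,n$, form a weakly increasing sequence whose distinct values form a maximal chain $y=w_0\lessdot w_1\lessdot\cdots\lessdot w_r=z$ of $[y,z]$ (the induced chain); for $i=1,\dots,r$ let $c_i$ be the least index $j$ with $(x_j\vee y)\wedge_y z=w_i$, and set $m_i=l_{c_i}$. Let $\delta$ be the edge-labelling of the bounded poset $[y,z]$ induced by the chain $w_0\lessdot\cdots\lessdot w_r$ and the label set $\{m_i\}$. Then $\delta$ agrees with the restriction of $\gamma$ to the edges of $[y,z]$.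
   Context: A poset is bounded if it has unique minimum $\hat0$ and maximum $\hat1$. $x\vee y$, $x\wedge y$ denote least common upper bound / greatest common lower bound when they exist. For $w,z\ge y$, $w\wedge_y z$ is the greatest element of $\{u: y\le u\le w,\ u\le z\}$ if it exists; for $w,y\le z$, $w\vee^z y$ is the least element of $\{u: w,y\le u\le z\}$ if it exists. An element $x$ is viable if for all $y\le z$ both $(x\vee y)\wedge_y z$ and $(x\wedge z)\vee^z y$ exist; a viable $x$ is left modular if $(x\vee y)\wedge_y z=(x\wedge z)\vee^z y$ for all $y\le z$. A maximal chain is left modular if all its elements are viable and left modular. Given a bounded poset $Q$ with a left modular maximal chain $\hat0=v_0\lessdot\cdots\lessdot v_k=\hat1$ and integers $p_1<\cdots<p_k$, the induced edge-labelling assigns to a cover $s\lessdot t$ of $Q$ the label $p_i$ where $i$ is such that $(v_{i-1}\vee s)\wedge_s t=s$ and $(v_i\vee s)\wedge_s t=t$ (meets and joins computed in $Q$). -}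

module Defs where

open import Level using (Level; _⊔_)
open import Relation.Binary.Bundles using (Poset)
open import Relation.Binary.Definitions using (Decidable)
import Relation.Binary.Construct.On as On
open import Data.Product using (Σ; Σ-syntax; _×_; _,_; proj₁; proj₂)
open import Data.Nat using (ℕ; zero; suc) renaming (_<_ to _<ℕ_; _≤_ to _≤ℕ_)
open import Data.Integer using (ℤ) renaming (_<_ to _<ℤ_)
open import Data.List using (List)
import Data.List.Membership.Setoid as SetoidMembership
open import Relation.Nullary using (¬_)
open import Relation.Binary.PropositionalEquality using (_≡_)
open import Function.Bundles using (_⇔_)

-- All notions are defined for an arbitrary (setoid-based) poset, so that they
-- can be applied both to P and to the interval [y,z] regarded as a poset.
module _ {c ℓ₁ ℓ₂ : Level} (P : Poset c ℓ₁ ℓ₂) where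
  open Poset P renaming (Carrier to A)
  open SetoidMembership (Poset.Eq.setoid P) using (_∈_)

  Lt : A → A → Set (ℓ₁ ⊔ ℓ₂)
  Lt x y = x ≤ y × ¬ (x ≈ y)

  Covers : A → A → Set (c ⊔ ℓ₁ ⊔ ℓ₂)
  Covers x y = Lt x y × (∀ u → ¬ (Lt x u × Lt u y))

  -- finite poset (constructively: finitely enumerable, decidable order)
  FinitePoset : Set (c ⊔ ℓ₁ ⊔ ℓ₂)
  FinitePoset = (Σ[ xs ∈ List A ] (∀ a → a ∈ xs)) × Decidable _≤_

  IsBottom : A → Set (c ⊔ ℓ₂)
  IsBottom b = ∀ x → b ≤ x

  IsTop : A → Set (c ⊔ ℓ₂)
  IsTop t = ∀ x → x ≤ t

  Bounded : Set (c ⊔ ℓ₂)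
  Bounded = Σ A IsBottom × Σ A IsTop

  IsJoin : A → A → A → Set (c ⊔ ℓ₂)
  IsJoin x y j = x ≤ j × y ≤ j × (∀ u → x ≤ u → y ≤ u → j ≤ u)

  IsMeet : A → A → A → Set (c ⊔ ℓ₂)
  IsMeet x y m = m ≤ x × m ≤ y × (∀ u → u ≤ x → u ≤ y → u ≤ m)

  IsRelMeet : A → A → A → A → Set (c ⊔ ℓ₂)
  IsRelMeet y w z u =
    (y ≤ u × u ≤ w × u ≤ z) × (∀ v → y ≤ v → v ≤ w → v ≤ z → v ≤ u)

  IsRelJoin : A → A → A → A → Set (c ⊔ ℓ₂)
  IsRelJoin w y z u =
    (w ≤ u × y ≤ u × u ≤ z) × (∀ v → w ≤ v → y ≤ v → v ≤ z → u ≤ v)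

  JoinRelMeet : A → A → A → A → Set (c ⊔ ℓ₂)
  JoinRelMeet a y z u = Σ[ j ∈ A ] (IsJoin a y j × IsRelMeet y j z u)

  MeetRelJoin : A → A → A → A → Set (c ⊔ ℓ₂)
  MeetRelJoin a y z u = Σ[ m ∈ A ] (IsMeet a z m × IsRelJoin m y z u)

  Viable : A → Set (c ⊔ ℓ₂)
  Viable a = ∀ y z → y ≤ z →
    Σ A (JoinRelMeet a y z) × Σ A (MeetRelJoin a y z)

  LeftModular : A → Set (c ⊔ ℓ₁ ⊔ ℓ₂)
  LeftModular a = Viable a ×
    (∀ y z → y ≤ z → ∀ u v → JoinRelMeet a y z u → MeetRelJoin a y z v → u ≈ v)

  MaximalChain : ℕ → (ℕ → A) → Set (c ⊔ ℓ₁ ⊔ ℓ₂)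
  MaximalChain n x =
    IsBottom (x 0) × IsTop (x n) × (∀ i → i <ℕ n → Covers (x i) (x (suc i)))

  LeftModularChain : ℕ → (ℕ → A) → Set (c ⊔ ℓ₁ ⊔ ℓ₂)
  LeftModularChain n x = MaximalChain n x × (∀ i → i ≤ℕ n → LeftModular (x i))

  -- induced edge-labelling (as a relation): the cover s ⋖ t gets label p
  -- iff p = l i with (x (i-1) ∨ s) ∧_s t = s and (x i ∨ s) ∧_s t = t, 1 ≤ i ≤ n.
  -- (Labels l_1 < ... < l_n are the values l 1, ..., l n.)
  InducedLabel : ℕ → (ℕ → A) → (ℕ → ℤ) → A → A → ℤ → Set (c ⊔ ℓ₂)
  InducedLabel n x l s t p =
    Σ[ k ∈ ℕ ] (k <ℕ n × JoinRelMeet (x k) s t s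
                      × JoinRelMeet (x (suc k)) s t t × p ≡ l (suc k))

StrictlyIncreasingOn : ℕ → (ℕ → ℤ) → Set
StrictlyIncreasingOn n l = ∀ i j → 1 ≤ℕ i → i <ℕ j → j ≤ℕ n → l i <ℤ l j

Interval : ∀ {c ℓ₁ ℓ₂} (P : Poset c ℓ₁ ℓ₂) → Poset.Carrier P → Poset.Carrier P →
           Poset (c ⊔ ℓ₂) ℓ₁ ℓ₂
Interval P y z =
  On.poset {B = Σ[ u ∈ Poset.Carrier P ] (Poset._≤_ P y u × Poset._≤_ P u z)} P proj₁

{-# OPTIONS --safe #-}
-- Write u j = (x j ∨ y) ∧_y z.  Left modularity of x j turns this into (x j ∧ z) ∨^z y,
-- and two consequences follow.  First, consecutive distinct values u j < u (j+1) form a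
-- cover: an element v strictly between them would put x j ∨ (x (j+1) ∧ v) strictly
-- between x j and x (j+1).  Second, for y ≤ s ≤ z the join of u j and s in [y,z] is
-- (x j ∨ s) ∧_s z, so for a cover s ⋖ t the condition t ≤ x k ∨ s of P is the condition
-- t ≤ u k ∨ s of [y,z].  The label of s ⋖ t is l k for the k at which this condition
-- starts to hold; being upward closed in u k, it starts to hold along the chain w of
-- distinct values of u exactly at the step whose first index c i is that k.
module Submission where

open import Defs
open import Level using (Level; _⊔_)
open import Relation.Binary.Bundles using (Poset; Setoid)
open import Data.Product using (Σ; Σ-syntax; _×_; _,_; proj₁; proj₂; map₁) renaming (map to Σ-map)
open import Data.Nat using (ℕ; zero; suc) renaming (_<_ to _<ℕ_; _≤_ to _≤ℕ_)
open import Data.Integer using (ℤ)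
open import Relation.Nullary using (¬_)
open import Function.Bundles using (_⇔_)

open import Data.Nat using (z≤n; s≤s; _⊓_; _≤′_; ≤′-refl; ≤′-step) renaming (_≤?_ to _≤ℕ?_)
open import Data.Nat.Properties
  using (<⇒≤; ≤-refl; ≤-trans; ≤-pred; ≰⇒>; n<1+n; <-cmp; ≤⇒≤′; m⊓n≤n; m≤n⇒m⊓n≡m)
open import Data.Sum using (_⊎_; inj₁; inj₂; [_,_]′)
open import Data.Empty using (⊥-elim)
open import Function using (_∘_)
open import Function.Bundles using (mk⇔; Equivalence)
import Function.Related.Propositional as Related
open import Function.Properties.Equivalence using () renaming (sym to ⇔-sym; trans to ⇔-trans)
open import Relation.Binary.Definitions using (Decidable; tri<; tri≈; tri>)
open import Relation.Binary.Properties.Poset using (≤-dec⇒≈-dec)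
open import Relation.Nullary using (yes; no; contradiction)
import Relation.Binary.PropositionalEquality as ≡

JumpLabel : ∀ {a b} {L : Set b} → (ℕ → Set a) → ℕ → (ℕ → L) → L → Set (a ⊔ b)
JumpLabel F n l p = Σ[ k ∈ ℕ ] (k <ℕ n × ¬ F k × F (suc k) × p ≡.≡ l (suc k))

jumpLabel-cong : ∀ {a b c} {L : Set c} {F : ℕ → Set a} {G : ℕ → Set b} {n l} {p : L} →
                 (∀ k → k ≤ℕ n → F k ⇔ G k) → JumpLabel F n l p ⇔ JumpLabel G n l p
jumpLabel-cong F⇔G = mk⇔
  (λ (k , k<n , ¬Fk , Fk′ , p≡) →
     k , k<n , ¬Fk ∘ Equivalence.from (F⇔G k (<⇒≤ k<n)) , Equivalence.to (F⇔G (suc k) k<n) Fk′ , p≡)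
  (λ (k , k<n , ¬Gk , Gk′ , p≡) →
     k , k<n , ¬Gk ∘ Equivalence.to (F⇔G k (<⇒≤ k<n)) , Equivalence.from (F⇔G (suc k) k<n) Gk′ , p≡)

module _ {c ℓ} (S : Setoid c ℓ) where
  open Setoid S renaming (Carrier to A)

  FirstOccurrence : ℕ → (ℕ → A) → A → ℕ → Set ℓ
  FirstOccurrence n u v c = c ≤ℕ n × u c ≈ v × (∀ j → j <ℕ c → ¬ u j ≈ v)

  -- w 0, …, w r is u 0, …, u n with each run of consecutive equal values collapsed.
  record Deduplication (u : ℕ → A) (n : ℕ) : Set (c ⊔ ℓ) where
    field
      r : ℕ
      w : ℕ → A
      w-first : w 0 ≈ u 0
      w-last  : w r ≈ u n
      w-step  : ∀ i → i <ℕ r →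
                Σ[ j ∈ ℕ ] (j <ℕ n × u j ≈ w i × u (suc j) ≈ w (suc i) × ¬ u j ≈ u (suc j))
      w-in-u  : ∀ i → i ≤ℕ r → Σ[ j ∈ ℕ ] (j ≤ℕ n × u j ≈ w i)
      u-in-w  : ∀ j → j ≤ℕ n → Σ[ i ∈ ℕ ] (i ≤ℕ r × u j ≈ w i)

  deduplicate : Decidable _≈_ → ∀ u n → Deduplication u n
  deduplicate _ u zero = record
    { r = 0 ; w = λ _ → u 0 ; w-first = refl ; w-last = refl
    ; w-step = λ _ ()
    ; w-in-u = λ _ _ → 0 , z≤n , refl
    ; u-in-w = λ { _ z≤n → 0 , z≤n , refl } }
  deduplicate _≟_ u (suc n) with deduplicate _≟_ (u ∘ suc) n | u 0 ≟ u 1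
  ... | D | yes u₀≈u₁ = record
    { r = r ; w = w ; w-first = trans w-first (sym u₀≈u₁) ; w-last = w-last
    ; w-step = λ i i<r → Σ-map suc (map₁ s≤s) (w-step i i<r)
    ; w-in-u = λ i i≤r → Σ-map suc (map₁ s≤s) (w-in-u i i≤r)
    ; u-in-w = λ { zero _ → 0 , z≤n , trans u₀≈u₁ (sym w-first)
                 ; (suc j) (s≤s j≤n) → u-in-w j j≤n } }
    where open Deduplication D
  ... | D | no u₀≉u₁ = record
    { r = suc r ; w = w′ ; w-first = refl ; w-last = w-last
    ; w-step = λ { zero _ → 0 , s≤s z≤n , refl , sym w-first , u₀≉u₁
                 ; (suc i) (s≤s i<r) → Σ-map suc (map₁ s≤s) (w-step i i<r) }
    ; w-in-u = λ { zero _ → 0 , z≤n , refl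
                 ; (suc i) (s≤s i≤r) → Σ-map suc (map₁ s≤s) (w-in-u i i≤r) }
    ; u-in-w = λ { zero _ → 0 , z≤n , refl
                 ; (suc j) (s≤s j≤n) → Σ-map suc (map₁ s≤s) (u-in-w j j≤n) } }
    where
    open Deduplication D
    w′ : ℕ → A
    w′ zero = u 0
    w′ (suc i) = w i

module PosetFacts {c ℓ₁ ℓ₂} (Q : Poset c ℓ₁ ℓ₂) where
  open Poset Q renaming (Carrier to A)

  step-mono : ∀ {f : ℕ → A} {n} → (∀ k → k <ℕ n → f k ≤ f (suc k)) →
              ∀ {i j} → i ≤ℕ j → j ≤ℕ n → f i ≤ f j
  step-mono {f} {n} step i≤j = go (≤⇒≤′ i≤j)
    where
    go : ∀ {i j} → i ≤′ j → j ≤ℕ n → f i ≤ f j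
    go ≤′-refl        _   = refl
    go (≤′-step i≤′j) j<n = trans (go i≤′j (<⇒≤ j<n)) (step _ j<n)

  join-mono : ∀ {a b J a′ b′ J′} → IsJoin Q a b J → IsJoin Q a′ b′ J′ →
              a ≤ a′ → b ≤ b′ → J ≤ J′
  join-mono (_ , _ , least) (a′≤J′ , b′≤J′ , _) a≤a′ b≤b′ =
    least _ (trans a≤a′ a′≤J′) (trans b≤b′ b′≤J′)

  meet-mono : ∀ {a b M a′ b′ M′} → IsMeet Q a b M → IsMeet Q a′ b′ M′ →
              a ≤ a′ → b ≤ b′ → M ≤ M′
  meet-mono (M≤a , M≤b , _) (_ , _ , greatest) a≤a′ b≤b′ =
    greatest _ (trans M≤a a≤a′) (trans M≤b b≤b′)

  join-respˡ : ∀ {a a′ b J} → a ≈ a′ → IsJoin Q a b J → IsJoin Q a′ b J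
  join-respˡ a≈a′ (a≤J , b≤J , least) =
    ≤-respˡ-≈ a≈a′ a≤J , b≤J , λ v a′≤v → least v (≤-respˡ-≈ (Eq.sym a≈a′) a′≤v)

  -- t ≤ a ∨ s, phrased so that it makes sense, and is monotone in a, without the join.
  BelowJoin : A → A → A → Set (c ⊔ ℓ₂)
  BelowJoin t a s = ∀ b → a ≤ b → s ≤ b → t ≤ b

  belowJoin-mono : ∀ {t a a′ s} → a ≤ a′ → BelowJoin t a s → BelowJoin t a′ s
  belowJoin-mono a≤a′ t≤a∨s b a′≤b = t≤a∨s b (trans a≤a′ a′≤b)

  belowJoin⇔≤join : ∀ {t a s J} → IsJoin Q a s J → BelowJoin t a s ⇔ t ≤ J
  belowJoin⇔≤join (a≤J , s≤J , least) =
    mk⇔ (λ t≤a∨s → t≤a∨s _ a≤J s≤J) (λ t≤J b a≤b s≤b → trans t≤J (least b a≤b s≤b))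

  joinRelMeet-lower : ∀ {a y z u} → JoinRelMeet Q a y z u → y ≤ u
  joinRelMeet-lower (_ , _ , (y≤u , _ , _) , _) = y≤u

  joinRelMeet-upper : ∀ {a y z u} → JoinRelMeet Q a y z u → u ≤ z
  joinRelMeet-upper (_ , _ , (_ , _ , u≤z) , _) = u≤z

  joinRelMeet-≤-join : ∀ {a y z u J} → JoinRelMeet Q a y z u → IsJoin Q a y J → u ≤ J
  joinRelMeet-≤-join (_ , a∨y , (_ , u≤J₀ , _) , _) a∨y′ = trans u≤J₀ (join-mono a∨y a∨y′ refl refl)

  joinRelMeet-greatest : ∀ {a y z u J v} → JoinRelMeet Q a y z u → IsJoin Q a y J →
                         y ≤ v → v ≤ J → v ≤ z → v ≤ u
  joinRelMeet-greatest (_ , a∨y , _ , greatest) a∨y′ y≤v v≤J =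
    greatest _ y≤v (trans v≤J (join-mono a∨y′ a∨y refl refl))

  joinRelMeet-mono : ∀ {a b y z u u′} → a ≤ b →
                     JoinRelMeet Q a y z u → JoinRelMeet Q b y z u′ → u ≤ u′
  joinRelMeet-mono a≤b ju@(_ , a∨y , _) (_ , b∨y , _ , greatest) =
    greatest _ (joinRelMeet-lower ju) (trans (joinRelMeet-≤-join ju a∨y) (join-mono a∨y b∨y a≤b refl))
      (joinRelMeet-upper ju)

  joinRelMeet-unique : ∀ {a y z u u′} → JoinRelMeet Q a y z u → JoinRelMeet Q a y z u′ → u ≈ u′
  joinRelMeet-unique ju ju′ = antisym (joinRelMeet-mono refl ju ju′) (joinRelMeet-mono refl ju′ ju)

  joinRelMeet-resp : ∀ {a y z u u′} → u ≈ u′ → JoinRelMeet Q a y z u → JoinRelMeet Q a y z u′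
  joinRelMeet-resp u≈u′ (J , a∨y , (y≤u , u≤J , u≤z) , greatest) =
    J , a∨y ,
    (≤-respʳ-≈ u≈u′ y≤u , ≤-respˡ-≈ u≈u′ u≤J , ≤-respˡ-≈ u≈u′ u≤z) ,
    λ v y≤v v≤J v≤z → ≤-respʳ-≈ u≈u′ (greatest v y≤v v≤J v≤z)

  joinRelMeet-≈-lower : ∀ {a y z u} → a ≤ y → JoinRelMeet Q a y z u → u ≈ y
  joinRelMeet-≈-lower a≤y ju =
    antisym (joinRelMeet-≤-join ju (a≤y , refl , λ _ _ y≤b → y≤b)) (joinRelMeet-lower ju)

  joinRelMeet-≈-upper : ∀ {a y z u} → z ≤ a → y ≤ z → JoinRelMeet Q a y z u → u ≈ z
  joinRelMeet-≈-upper z≤a y≤z ju@(_ , a∨y , _) =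
    antisym (joinRelMeet-upper ju) (joinRelMeet-greatest ju a∨y y≤z (trans z≤a (proj₁ a∨y)) refl)

  module _ {s t} (s<t : Lt Q s t) {a J} (a∨s : IsJoin Q a s J) where

    joinRelMeet-t⇔belowJoin : JoinRelMeet Q a s t t ⇔ BelowJoin t a s
    joinRelMeet-t⇔belowJoin = mk⇔
      (λ { (_ , a∨s₀ , (_ , t≤J₀ , _) , _) → Equivalence.from (belowJoin⇔≤join a∨s₀) t≤J₀ })
      (λ t≤a∨s → J , a∨s , (proj₁ s<t , Equivalence.to (belowJoin⇔≤join a∨s) t≤a∨s , refl) ,
                 λ _ _ _ v≤t → v≤t)

    joinRelMeet-s⇔¬belowJoin : Decidable _≤_ → Covers Q s t →
                               JoinRelMeet Q a s t s ⇔ (¬ BelowJoin t a s)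
    joinRelMeet-s⇔¬belowJoin _≤?_ (_ , nothing-between) = mk⇔
      (λ { ju@(_ , a∨s₀ , _) t≤a∨s →
           proj₂ s<t (antisym (proj₁ s<t)
             (joinRelMeet-greatest ju a∨s₀ (proj₁ s<t)
               (Equivalence.to (belowJoin⇔≤join a∨s₀) t≤a∨s) refl)) })
      (λ t≰a∨s → J , a∨s , (refl , proj₁ (proj₂ a∨s) , proj₁ s<t) , greatest t≰a∨s)
      where
      greatest : ¬ BelowJoin t a s → ∀ v → s ≤ v → v ≤ J → v ≤ t → v ≤ s
      greatest t≰a∨s v s≤v v≤J v≤t with v ≤? s
      ... | yes v≤s = v≤s
      ... | no v≰s = ⊥-elim (nothing-between v
            ( (s≤v , λ s≈v → v≰s (reflexive (Eq.sym s≈v)))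
            , (v≤t , λ v≈t → t≰a∨s (Equivalence.from (belowJoin⇔≤join a∨s) (≤-respˡ-≈ v≈t v≤J)))))

  inducedLabel⇔jumpLabel : Decidable _≤_ → ∀ {n x l s t p} → Covers Q s t →
    (∀ k → k ≤ℕ n → Σ A (IsJoin Q (x k) s)) →
    InducedLabel Q n x l s t p ⇔ JumpLabel (λ k → BelowJoin t (x k) s) n l p
  inducedLabel⇔jumpLabel _≤?_ {n} {x} {s = s} {t} s⋖t@(s<t , _) joins = mk⇔
    (λ (k , k<n , js , jt , p≡) → k , k<n ,
       Equivalence.to (s⇔ k (<⇒≤ k<n)) js , Equivalence.to (t⇔ (suc k) k<n) jt , p≡)
    (λ (k , k<n , ¬bk , bk′ , p≡) → k , k<n ,
       Equivalence.from (s⇔ k (<⇒≤ k<n)) ¬bk , Equivalence.from (t⇔ (suc k) k<n) bk′ , p≡)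
    where
    s⇔ : ∀ k → k ≤ℕ n → JoinRelMeet Q (x k) s t s ⇔ (¬ BelowJoin t (x k) s)
    s⇔ k k≤n = joinRelMeet-s⇔¬belowJoin s<t (proj₂ (joins k k≤n)) _≤?_ s⋖t
    t⇔ : ∀ k → k ≤ℕ n → JoinRelMeet Q (x k) s t t ⇔ BelowJoin t (x k) s
    t⇔ k k≤n = joinRelMeet-t⇔belowJoin s<t (proj₂ (joins k k≤n))

  module _ {a} (a-lm : LeftModular Q a) where

    lm-join : ∀ b → Σ A (IsJoin Q a b)
    lm-join b = let (_ , J , a∨b , _) , _ = proj₁ a-lm b b refl in J , a∨b

    lm-meet : ∀ b → Σ A (IsMeet Q a b)
    lm-meet b = let _ , (_ , M , a∧b , _) = proj₁ a-lm b b refl in M , a∧b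

    lm-joinRelMeet : ∀ {y z} → y ≤ z → Σ A (JoinRelMeet Q a y z)
    lm-joinRelMeet y≤z = proj₁ (proj₁ a-lm _ _ y≤z)

    private
      lm-meetRelJoin : ∀ {y z u} → y ≤ z → JoinRelMeet Q a y z u →
                       Σ[ v ∈ A ] (u ≈ v × MeetRelJoin Q a y z v)
      lm-meetRelJoin y≤z ju =
        let v , mv = proj₂ (proj₁ a-lm _ _ y≤z) in v , proj₂ a-lm _ _ y≤z _ v ju mv , mv

    lm-meet≤joinRelMeet : ∀ {y z u M} → y ≤ z → JoinRelMeet Q a y z u → IsMeet Q a z M → M ≤ u
    lm-meet≤joinRelMeet y≤z ju a∧z =
      let _ , u≈v , _ , a∧z₀ , (M₀≤v , _) , _ = lm-meetRelJoin y≤z ju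
      in ≤-respʳ-≈ (Eq.sym u≈v) (trans (meet-mono a∧z a∧z₀ refl refl) M₀≤v)

    lm-joinRelMeet-least : ∀ {y z u M v} → y ≤ z → JoinRelMeet Q a y z u → IsMeet Q a z M →
                           y ≤ v → v ≤ z → M ≤ v → u ≤ v
    lm-joinRelMeet-least y≤z ju a∧z y≤v v≤z M≤v =
      let _ , u≈v₀ , _ , a∧z₀ , _ , least = lm-meetRelJoin y≤z ju
      in ≤-respˡ-≈ (Eq.sym u≈v₀) (least _ (trans (meet-mono a∧z₀ a∧z refl refl) M≤v) y≤v v≤z)

  private
    gap-below : ∀ {a b m y z u u′ v} → LeftModular Q a → LeftModular Q b →
                IsMeet Q b v m → m ≤ a → y ≤ v →
                JoinRelMeet Q a y z u → JoinRelMeet Q b y z u′ → v ≤ u′ → v ≤ u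
    gap-below {v = v} a-lm b-lm b∧v m≤a y≤v ju ju′ v≤u′ =
      let _ , a∨y    = lm-join a-lm _
          _ , b∨y    = lm-join b-lm _
          _ , a∧v    = lm-meet a-lm v
          _ , jq     = lm-joinRelMeet b-lm y≤v
          _ , jq′    = lm-joinRelMeet a-lm y≤v
          v≤q        = joinRelMeet-greatest jq b∨y y≤v (trans v≤u′ (joinRelMeet-≤-join ju′ b∨y)) refl
          m≤a∧v      = proj₂ (proj₂ a∧v) _ m≤a (proj₁ (proj₂ b∧v))
          q≤q′       = lm-joinRelMeet-least b-lm y≤v jq b∧v (joinRelMeet-lower jq′) (joinRelMeet-upper jq′)
                         (trans m≤a∧v (lm-meet≤joinRelMeet a-lm y≤v jq′ a∧v))
          v≤Ja       = trans v≤q (trans q≤q′ (joinRelMeet-≤-join jq′ a∨y))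
      in joinRelMeet-greatest ju a∨y y≤v v≤Ja (trans v≤u′ (joinRelMeet-upper ju′))

    gap-above : ∀ {a b y z u u′ v} → LeftModular Q a → v ≤ z →
                JoinRelMeet Q a y z u → JoinRelMeet Q b y z u′ → u ≤ v → v ≤ u′ →
                BelowJoin b a v → u′ ≤ v
    gap-above {z = z} {v = v} a-lm v≤z ju ju′@(_ , b∨y , _) u≤v v≤u′ b≤a∨v =
      let y≤v        = trans (joinRelMeet-lower ju) u≤v
          y≤z        = trans y≤v v≤z
          N , a∨v    = lm-join a-lm v
          _ , a∧z    = lm-meet a-lm z
          _ , jq     = lm-joinRelMeet a-lm v≤z
          q≤v        = lm-joinRelMeet-least a-lm v≤z jq a∧z refl v≤z
                         (trans (lm-meet≤joinRelMeet a-lm y≤z ju a∧z) u≤v)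
          v≤N        = proj₁ (proj₂ a∨v)
          b∨y≤N      = proj₂ (proj₂ b∨y) N (b≤a∨v N (proj₁ a∨v) v≤N) (trans y≤v v≤N)
          u′≤q       = joinRelMeet-greatest jq a∨v v≤u′
                         (trans (joinRelMeet-≤-join ju′ b∨y) b∨y≤N) (joinRelMeet-upper ju′)
      in trans u′≤q q≤v

  -- K = a ∨ (b ∧ v) lies between a ⋖ b; K = a gives v ≤ u and K = b gives u′ ≤ v.
  joinRelMeet-cover-gap : Decidable _≤_ → ∀ {a b y z u u′ v} →
    LeftModular Q a → LeftModular Q b → Covers Q a b → y ≤ v → v ≤ z →
    JoinRelMeet Q a y z u → JoinRelMeet Q b y z u′ → u ≤ v → v ≤ u′ → v ≤ u ⊎ u′ ≤ v
  joinRelMeet-cover-gap _≤?_ {a} {b} {v = v} a-lm b-lm ((a≤b , _) , nothing-between)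
                        y≤v v≤z ju ju′ u≤v v≤u′
    with lm-meet b-lm v
  ... | m , b∧v@(m≤b , m≤v , _) with lm-join a-lm m
  ... | K , (a≤K , m≤K , K-least) with K ≤? a | b ≤? K
  ... | yes K≤a | _ = inj₁ (gap-below a-lm b-lm b∧v (trans m≤K K≤a) y≤v ju ju′ v≤u′)
  ... | no _ | yes b≤K =
    inj₂ (gap-above a-lm v≤z ju ju′ u≤v v≤u′ (λ N a≤N v≤N → trans b≤K (K-least N a≤N (trans m≤v v≤N))))
  ... | no K≰a | no b≰K = ⊥-elim (nothing-between K
    ( (a≤K , λ a≈K → K≰a (reflexive (Eq.sym a≈K)))
    , (K-least b a≤b m≤b , λ K≈b → b≰K (reflexive (Eq.sym K≈b)))))

  module MonotoneDeduplication {u : ℕ → A} {n} (u-step : ∀ j → j <ℕ n → u j ≤ u (suc j))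
                               (D : Deduplication Eq.setoid u n) where
    open Deduplication D

    u-mono : ∀ {i j} → i ≤ℕ j → j ≤ℕ n → u i ≤ u j
    u-mono = step-mono u-step

    w-increasing : ∀ i → i <ℕ r → Lt Q (w i) (w (suc i))
    w-increasing i i<r =
      let j , j<n , uj≈wi , uj′≈wi′ , uj≉uj′ = w-step i i<r
      in trans (reflexive (Eq.sym uj≈wi)) (trans (u-step j j<n) (reflexive uj′≈wi′)) ,
         λ wi≈wi′ → uj≉uj′ (Eq.trans uj≈wi (Eq.trans wi≈wi′ (Eq.sym uj′≈wi′)))

    w-mono : ∀ {i j} → i ≤ℕ j → j ≤ℕ r → w i ≤ w j
    w-mono = step-mono (λ i i<r → proj₁ (w-increasing i i<r))

    jumpLabel-deduplicate : ∀ {f} {F : A → Set f} → (∀ {a b} → a ≤ b → F a → F b) →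
      ∀ {b} {L : Set b} {l : ℕ → L} {cc : ℕ → ℕ} →
      (∀ i → 1 ≤ℕ i → i ≤ℕ r → FirstOccurrence Eq.setoid n u (w i) (cc i)) →
      ∀ {p} → JumpLabel (F ∘ u) n l p ⇔ JumpLabel (F ∘ w) r (l ∘ cc) p
    jumpLabel-deduplicate {F = F} F-mono {l = l} {cc} first {p} = mk⇔ to from
      where
      F-resp : ∀ {a b} → a ≈ b → F a → F b
      F-resp = F-mono ∘ reflexive

      to : JumpLabel (F ∘ u) n l p → JumpLabel (F ∘ w) r (l ∘ cc) p
      to (k , k<n , ¬Fuk , Fuk′ , p≡) with u-in-w (suc k) k<n
      ... | zero , _ , uk′≈w₀ =
        contradiction (F-mono (trans (reflexive (Eq.trans uk′≈w₀ w-first)) (u-mono z≤n (<⇒≤ k<n))) Fuk′)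
                      ¬Fuk
      ... | suc i , i<r , uk′≈wi′ =
        i , i<r , ¬Fwi , F-resp uk′≈wi′ Fuk′ , ≡.trans p≡ (≡.cong l (≡.sym cc≡k′))
        where
        ¬Fwi : ¬ F (w i)
        ¬Fwi Fwi with w-in-u i (<⇒≤ i<r)
        ... | d , d≤n , ud≈wi with d ≤ℕ? k
        ... | yes d≤k = ¬Fuk (F-mono (u-mono d≤k (<⇒≤ k<n)) (F-resp (Eq.sym ud≈wi) Fwi))
        ... | no d≰k = proj₂ (w-increasing i i<r) (antisym (proj₁ (w-increasing i i<r))
                (trans (reflexive (Eq.sym uk′≈wi′)) (trans (u-mono (≰⇒> d≰k) d≤n) (reflexive ud≈wi))))

        cc≡k′ : cc (suc i) ≡.≡ suc k
        cc≡k′ with first (suc i) (s≤s z≤n) i<r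
        ... | _ , uc≈wi′ , minimal with <-cmp (cc (suc i)) (suc k)
        ... | tri< c<k′ _ _ = contradiction (F-mono (u-mono (≤-pred c<k′) (<⇒≤ k<n))
                                (F-resp (Eq.trans uk′≈wi′ (Eq.sym uc≈wi′)) Fuk′)) ¬Fuk
        ... | tri≈ _ c≡k′ _ = c≡k′
        ... | tri> _ _ c>k′ = contradiction uk′≈wi′ (minimal (suc k) c>k′)

      from : JumpLabel (F ∘ w) r (l ∘ cc) p → JumpLabel (F ∘ u) n l p
      from (i , i<r , ¬Fwi , Fwi′ , p≡) = jump (cc (suc i)) (first (suc i) (s≤s z≤n) i<r) p≡
        where
        jump : ∀ c → FirstOccurrence Eq.setoid n u (w (suc i)) c → p ≡.≡ l c → JumpLabel (F ∘ u) n l p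
        jump zero (_ , u₀≈wi′ , _) _ =
          contradiction (F-mono (trans (reflexive (Eq.trans (Eq.sym u₀≈wi′) (Eq.sym w-first)))
                                       (w-mono z≤n (<⇒≤ i<r))) Fwi′) ¬Fwi
        jump (suc k) (k′≤n , uk′≈wi′ , minimal) p≡ = k , k′≤n , ¬Fuk , F-resp (Eq.sym uk′≈wi′) Fwi′ , p≡
          where
          ¬Fuk : ¬ F (u k)
          ¬Fuk Fuk with u-in-w k (<⇒≤ k′≤n)
          ... | m , m≤r , uk≈wm with m ≤ℕ? i
          ... | yes m≤i = ¬Fwi (F-mono (w-mono m≤i (<⇒≤ i<r)) (F-resp uk≈wm Fuk))
          ... | no m≰i = minimal k (n<1+n k) (antisym
                (trans (u-step k k′≤n) (reflexive uk′≈wi′))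
                (trans (w-mono (≰⇒> m≰i) m≤r) (reflexive (Eq.sym uk≈wm))))

module IntervalFacts {c ℓ₁ ℓ₂} (P : Poset c ℓ₁ ℓ₂) {y z : Poset.Carrier P} where
  open Poset P
  open PosetFacts P
  private
    I : Poset (c ⊔ ℓ₂) ℓ₁ ℓ₂
    I = Interval P y z
    module PI = PosetFacts I

  interval-covers : ∀ {s t} → Covers I s t → Covers P (proj₁ s) (proj₁ t)
  interval-covers {s} {t} (s<t , nothing-between) =
    s<t , λ v s<v<t@((s≤v , _) , (v≤t , _)) →
      nothing-between (v , trans (proj₁ (proj₂ s)) s≤v , trans v≤t (proj₂ (proj₂ t))) s<v<t

  module _ {a} (a-lm : LeftModular P a) (ũ : Poset.Carrier I) (ju : JoinRelMeet P a y z (proj₁ ũ))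
           (s : Poset.Carrier I) where
    private
      y≤s : y ≤ proj₁ s
      y≤s = proj₁ (proj₂ s)
      s≤z : proj₁ s ≤ z
      s≤z = proj₂ (proj₂ s)
      y≤z : y ≤ z
      y≤z = trans y≤s s≤z
      a∧z : IsMeet P a z (proj₁ (lm-meet a-lm z))
      a∧z = proj₂ (lm-meet a-lm z)
      jU : JoinRelMeet P a (proj₁ s) z (proj₁ (lm-joinRelMeet a-lm s≤z))
      jU = proj₂ (lm-joinRelMeet a-lm s≤z)

    lm-interval-join : Poset.Carrier I
    lm-interval-join = proj₁ (lm-joinRelMeet a-lm s≤z) ,
                       trans y≤s (joinRelMeet-lower jU) , joinRelMeet-upper jU

    lm-interval-isJoin : IsJoin I ũ s lm-interval-join
    lm-interval-isJoin =
      lm-joinRelMeet-least a-lm y≤z ju a∧z (trans y≤s (joinRelMeet-lower jU)) (joinRelMeet-upper jU)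
        (lm-meet≤joinRelMeet a-lm s≤z jU a∧z) ,
      joinRelMeet-lower jU ,
      λ v u≤v s≤v → lm-joinRelMeet-least a-lm s≤z jU a∧z s≤v (proj₂ (proj₂ v))
                      (trans (lm-meet≤joinRelMeet a-lm y≤z ju a∧z) u≤v)

    belowJoin-interval : ∀ (t : Poset.Carrier I) → proj₁ s ≤ proj₁ t →
                         BelowJoin (proj₁ t) a (proj₁ s) ⇔ PI.BelowJoin t ũ s
    belowJoin-interval t s≤t =
      ⇔-trans (⇔-trans (belowJoin⇔≤join {t = proj₁ t} a∨s) t≤J⇔t≤U)
              (⇔-sym (PI.belowJoin⇔≤join {t} {ũ} {s} {lm-interval-join} lm-interval-isJoin))
      where
      a∨s : IsJoin P a (proj₁ s) (proj₁ (lm-join a-lm (proj₁ s)))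
      a∨s = proj₂ (lm-join a-lm (proj₁ s))
      t≤J⇔t≤U : proj₁ t ≤ proj₁ (lm-join a-lm (proj₁ s)) ⇔ proj₁ t ≤ proj₁ lm-interval-join
      t≤J⇔t≤U = mk⇔ (λ t≤J → joinRelMeet-greatest jU a∨s s≤t t≤J (proj₂ (proj₂ t)))
                     (λ t≤U → trans t≤U (joinRelMeet-≤-join jU a∨s))

module InducedChain {c ℓ₁ ℓ₂} (P : Poset c ℓ₁ ℓ₂) (_≤?_ : Decidable (Poset._≤_ P))
                    {n x} (chain : LeftModularChain P n x) {y z} (y≤z : Poset._≤_ P y z) where
  open Poset P
  open PosetFacts P
  open IntervalFacts P {y} {z}

  I : Poset (c ⊔ ℓ₂) ℓ₁ ℓ₂
  I = Interval P y z
  module PI = PosetFacts I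

  x-lm : ∀ j → j ≤ℕ n → LeftModular P (x j)
  x-lm = proj₂ chain

  x-covers : ∀ j → j <ℕ n → Covers P (x j) (x (suc j))
  x-covers = proj₂ (proj₂ (proj₁ chain))

  joinRelMeet-step : ∀ j {u u′} → j <ℕ n → JoinRelMeet P (x j) y z u →
                     JoinRelMeet P (x (suc j)) y z u′ → u ≤ u′
  joinRelMeet-step j j<n = joinRelMeet-mono (proj₁ (proj₁ (x-covers j j<n)))

  -- Indices beyond n are clamped to n.
  u : ℕ → Poset.Carrier I
  u j = let v , jv = lm-joinRelMeet (x-lm (j ⊓ n) (m⊓n≤n j n)) y≤z
        in v , joinRelMeet-lower jv , joinRelMeet-upper jv

  u-joinRelMeet : ∀ j → j ≤ℕ n → JoinRelMeet P (x j) y z (proj₁ (u j))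
  u-joinRelMeet j j≤n = ≡.subst (λ k → JoinRelMeet P (x k) y z (proj₁ (u j))) (m≤n⇒m⊓n≡m j≤n)
                          (proj₂ (lm-joinRelMeet (x-lm (j ⊓ n) (m⊓n≤n j n)) y≤z))

  u-step : ∀ j → j <ℕ n → Poset._≤_ I (u j) (u (suc j))
  u-step j j<n = joinRelMeet-step j j<n (u-joinRelMeet j (<⇒≤ j<n)) (u-joinRelMeet (suc j) j<n)

  _≤I?_ : Decidable (Poset._≤_ I)
  a ≤I? b = proj₁ a ≤? proj₁ b

  dedup : Deduplication (Poset.Eq.setoid I) u n
  dedup = deduplicate (Poset.Eq.setoid I) (≤-dec⇒≈-dec I _≤I?_) u n

  open Deduplication dedup public
  open PI.MonotoneDeduplication u-step dedup

  w-first≈y : proj₁ (w 0) ≈ y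
  w-first≈y = Eq.trans w-first (joinRelMeet-≈-lower (proj₁ (proj₁ chain) y) (u-joinRelMeet 0 z≤n))

  w-last≈z : proj₁ (w r) ≈ z
  w-last≈z = Eq.trans w-last (joinRelMeet-≈-upper (proj₁ (proj₂ (proj₁ chain)) z) y≤z
                                (u-joinRelMeet n ≤-refl))

  w-covers : ∀ i → i <ℕ r → Covers I (w i) (w (suc i))
  w-covers i i<r with w-step i i<r
  ... | j , j<n , uj≈wi , uj′≈wi′ , _ =
    w-increasing i i<r ,
    λ v ((wi≤v , wi≉v) , (v≤wi′ , v≉wi′)) →
      [ (λ v≤uj → wi≉v (antisym wi≤v (≤-respʳ-≈ uj≈wi v≤uj)))
      , (λ uj′≤v → v≉wi′ (antisym v≤wi′ (≤-respˡ-≈ uj′≈wi′ uj′≤v)))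
      ]′ (joinRelMeet-cover-gap _≤?_ (x-lm j (<⇒≤ j<n)) (x-lm (suc j) j<n) (x-covers j j<n)
            (proj₁ (proj₂ v)) (proj₂ (proj₂ v))
            (u-joinRelMeet j (<⇒≤ j<n)) (u-joinRelMeet (suc j) j<n)
            (≤-respˡ-≈ (Eq.sym uj≈wi) wi≤v) (≤-respʳ-≈ (Eq.sym uj′≈wi′) v≤wi′))

  w-joinRelMeet : ∀ i → i ≤ℕ r → Σ[ j ∈ ℕ ] (j ≤ℕ n × JoinRelMeet P (x j) y z (proj₁ (w i)))
  w-joinRelMeet i i≤r =
    let j , j≤n , uj≈wi = w-in-u i i≤r in j , j≤n , joinRelMeet-resp uj≈wi (u-joinRelMeet j j≤n)

  joinRelMeet-in-w : ∀ j v → j ≤ℕ n → JoinRelMeet P (x j) y z v →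
                     Σ[ i ∈ ℕ ] (i ≤ℕ r × v ≈ proj₁ (w i))
  joinRelMeet-in-w j v j≤n jv =
    let i , i≤r , uj≈wi = u-in-w j j≤n
    in i , i≤r , Eq.trans (joinRelMeet-unique jv (u-joinRelMeet j j≤n)) uj≈wi

  firstOccurrence : ∀ {v k} →
    k ≤ℕ n × JoinRelMeet P (x k) y z (proj₁ v) ×
    (∀ j → j <ℕ k → ¬ JoinRelMeet P (x j) y z (proj₁ v)) →
    FirstOccurrence (Poset.Eq.setoid I) n u v k
  firstOccurrence (k≤n , jv , minimal) =
    k≤n , joinRelMeet-unique (u-joinRelMeet _ k≤n) jv ,
    λ j j<k uj≈v → minimal j j<k (joinRelMeet-resp uj≈v (u-joinRelMeet j (≤-trans (<⇒≤ j<k) k≤n)))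

  inducedLabel-interval : (l : ℕ → ℤ) (cc : ℕ → ℕ) →
    (∀ i → 1 ≤ℕ i → i ≤ℕ r → FirstOccurrence (Poset.Eq.setoid I) n u (w i) (cc i)) →
    ∀ s t → Covers I s t → ∀ p →
    InducedLabel P n x l (proj₁ s) (proj₁ t) p ⇔ InducedLabel I r w (λ i → l (cc i)) s t p
  inducedLabel-interval l cc first s t s⋖t p = begin
    InducedLabel P n x l (proj₁ s) (proj₁ t) p
      ∼⟨ inducedLabel⇔jumpLabel _≤?_ {l = l} (interval-covers {s} {t} s⋖t) x-join ⟩
    JumpLabel (λ k → BelowJoin (proj₁ t) (x k) (proj₁ s)) n l p
      ∼⟨ jumpLabel-cong {l = l} belowJoin-x⇔u ⟩
    JumpLabel (λ k → PI.BelowJoin t (u k) s) n l p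
      ∼⟨ jumpLabel-deduplicate (λ {a} {b} → PI.belowJoin-mono {t} {a} {b} {s}) {l = l} first ⟩
    JumpLabel (λ i → PI.BelowJoin t (w i) s) r (λ i → l (cc i)) p
      ∼⟨ ⇔-sym (PI.inducedLabel⇔jumpLabel _≤I?_ {r} {w} {λ i → l (cc i)} {s} {t} {p} s⋖t w-join) ⟩
    InducedLabel I r w (λ i → l (cc i)) s t p ∎
    where
    open Related.EquationalReasoning

    x-join : ∀ k → k ≤ℕ n → Σ Carrier (IsJoin P (x k) (proj₁ s))
    x-join k k≤n = lm-join (x-lm k k≤n) (proj₁ s)

    belowJoin-x⇔u : ∀ k → k ≤ℕ n → BelowJoin (proj₁ t) (x k) (proj₁ s) ⇔ PI.BelowJoin t (u k) s
    belowJoin-x⇔u k k≤n =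
      belowJoin-interval (x-lm k k≤n) (u k) (u-joinRelMeet k k≤n) s t (proj₁ (proj₁ s⋖t))

    w-join : ∀ i → i ≤ℕ r → Σ (Poset.Carrier I) (IsJoin I (w i) s)
    w-join i i≤r =
      let j , j≤n , uj≈wi = w-in-u i i≤r
          J = lm-interval-join (x-lm j j≤n) (u j) (u-joinRelMeet j j≤n) s
      in J , PI.join-respˡ {u j} {w i} {s} {J} uj≈wi
               (lm-interval-isJoin (x-lm j j≤n) (u j) (u-joinRelMeet j j≤n) s)

proposition1 :
    ∀ {c ℓ₁ ℓ₂ : Level} (P : Poset c ℓ₁ ℓ₂) → FinitePoset P → Bounded P →
    (n : ℕ) (x : ℕ → Poset.Carrier P) → LeftModularChain P n x →
    (l : ℕ → ℤ) → StrictlyIncreasingOn n l →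
    (y z : Poset.Carrier P) (y<z : Lt P y z) →
    let I = Interval P y z
        u≈ = Poset._≈_ P
        u≤ = Poset._≤_ P
    in
    -- the elements (x_j ∨ y) ∧_y z, j = 0..n, are weakly increasing
    (∀ j u u′ → j <ℕ n → JoinRelMeet P (x j) y z u →
       JoinRelMeet P (x (suc j)) y z u′ → u≤ u u′)
    ×
    -- their distinct values form a maximal chain y = w_0 ⋖ ... ⋖ w_r = z of [y,z]
    (Σ[ r ∈ ℕ ] Σ[ w ∈ (ℕ → Poset.Carrier I) ]
      ((u≈ (proj₁ (w 0)) y × u≈ (proj₁ (w r)) z
        × (∀ i → i <ℕ r → Covers I (w i) (w (suc i)))
        × (∀ i → i ≤ℕ r → Σ[ j ∈ ℕ ] (j ≤ℕ n × JoinRelMeet P (x j) y z (proj₁ (w i))))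
        × (∀ j u → j ≤ℕ n → JoinRelMeet P (x j) y z u →
             Σ[ i ∈ ℕ ] (i ≤ℕ r × u≈ u (proj₁ (w i)))))
      ×
      -- for c_i the least index j with (x_j ∨ y) ∧_y z = w_i, and m_i = l_{c_i},
      -- the labelling δ of [y,z] induced by (w, m) agrees with γ on edges of [y,z]
      (∀ (cc : ℕ → ℕ) →
        (∀ i → 1 ≤ℕ i → i ≤ℕ r →
           cc i ≤ℕ n × JoinRelMeet P (x (cc i)) y z (proj₁ (w i))
           × (∀ j → j <ℕ cc i → ¬ JoinRelMeet P (x j) y z (proj₁ (w i)))) →
        ∀ (s t : Poset.Carrier I) → Covers I s t → ∀ (p : ℤ) →
          InducedLabel P n x l (proj₁ s) (proj₁ t) p
            ⇔ InducedLabel I r w (λ i → l (cc i)) s t p)))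
proposition1 P (_ , _≤?_) _ n x chain l _ y z (y≤z , _) =
  (λ j _ _ → joinRelMeet-step j) ,
  ( r , w
  , (w-first≈y , w-last≈z , w-covers , w-joinRelMeet , joinRelMeet-in-w)
  , λ cc first → inducedLabel-interval l cc (λ i 1≤i i≤r → firstOccurrence {w i} (first i 1≤i i≤r)) )
  where open InducedChain P _≤?_ chain y≤z
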